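{- Let $f$ and $g$ be distinct elements of a matroid $M$. The following are equivalent: (i) $f$ is freer than $g$ in $M$; (ii) $b(f;N)\geq b(g;N)$ for every restriction $N$ of $M$ whose ground set contains $\{f,g\}$.
   Context: For distinct elements $f,g$ of a matroid $M$, $f$ is freer than $g$ if $g$ is contained in the closure of every circuit of $M$ that contains $f$. For a matroid $N$ and an element $e$ of $N$, $b(e;N)$ is the number of bases of $N$ containing $e$. -}

module Defs where

open import Data.Nat using (ℕ; zero; suc; _<_; _⊔_)
open import Data.Bool using (Bool; true; false; T; not; _∧_; if_then_else_)
open import Data.Fin using (Fin)
open import Data.Fin.Subset using (Subset; ⊥; ⁅_⁆; _∈_; _∉_; _⊆_; _⊂_; _∪_; ∣_∣; inside; outside)
open import Data.Fin.Subset.Properties using (_∈?_; _⊆?_)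
open import Data.List using (List; []; _∷_; map; _++_; filter; length; foldr; allFin)
open import Data.Vec using (_∷_; [])
open import Data.Product using (Σ; ∃; _×_; _,_)
open import Relation.Nullary using (¬_; Dec; yes; no)
open import Relation.Nullary.Decidable using (⌊_⌋; T?)
open import Relation.Binary.PropositionalEquality using (_≡_)

-- Independence is given as a Boolean test, so that
-- "independent" is decidable (automatic for finite matroids classically).
record Matroid (n : ℕ) : Set where
  field
    indep     : Subset n → Bool
    indep-⊥   : T (indep ⊥)
    indep-⊆   : ∀ {I J} → I ⊆ J → T (indep J) → T (indep I)
    indep-aug : ∀ {I J} → T (indep I) → T (indep J) → ∣ I ∣ < ∣ J ∣ →
                ∃ λ e → e ∈ J × e ∉ I × T (indep (I ∪ ⁅ e ⁆))

open Matroid public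

module _ {n : ℕ} (M : Matroid n) where

  Independent : Subset n → Set
  Independent I = T (indep M I)

  IsCircuit : Subset n → Set
  IsCircuit C = ¬ Independent C × (∀ D → D ⊂ C → Independent D)

allL : {A : Set} → (A → Bool) → List A → Bool
allL p = foldr (λ x b → p x ∧ b) true

allSubsets : (n : ℕ) → List (Subset n)
allSubsets zero    = [] ∷ []
allSubsets (suc n) = map (inside ∷_) (allSubsets n) ++ map (outside ∷_) (allSubsets n)

module _ {n : ℕ} (M : Matroid n) where

  rank : Subset n → ℕ
  rank X = foldr (λ I r → (if indep M I ∧ ⌊ I ⊆? X ⌋ then ∣ I ∣ else 0) ⊔ r) 0 (allSubsets n)

  _∈cl_ : Fin n → Subset n → Set
  e ∈cl X = rank (X ∪ ⁅ e ⁆) ≡ rank X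

  Freer : Fin n → Fin n → Set
  Freer f g = ∀ C → IsCircuit M C → f ∈ C → g ∈cl C

  isBasisOfRestriction : Subset n → Subset n → Bool
  isBasisOfRestriction X B =
    indep M B ∧ ⌊ B ⊆? X ⌋ ∧
    allL (λ x → not (⌊ x ∈? X ⌋ ∧ not ⌊ x ∈? B ⌋ ∧ indep M (B ∪ ⁅ x ⁆))) (allFin n)

  -- b(e; M|X) : number of bases of M|X containing e
  basesCount : Subset n → Fin n → ℕ
  basesCount X e = length (filter (λ B → T? (isBasisOfRestriction X B ∧ ⌊ e ∈? B ⌋)) (allSubsets n))

{-# OPTIONS --safe #-}
module Submission where

-- If f is freer than g, the transposition of f and g sends bases of M|X
-- containing g injectively to bases containing f.  The only non-trivial
-- case is a basis B with g ∈ B and f ∉ B: then B ∪ {f} contains a circuit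
-- C through f, and g ∈ cl(C) forces g ∈ C (otherwise (C − f) ∪ {g} ⊆ B
-- would be an independent set of size |C| inside cl(C)), so B − g + f is
-- again a basis.  Conversely, if some circuit C ∋ f has g ∉ cl(C), then g
-- lies in every basis of M|(C ∪ {g}), whereas extending C − f to a basis
-- yields one avoiding f; so strictly more bases contain g than f.

open import Data.Bool using (Bool; true; false; T; not; _∧_; if_then_else_)
open import Data.Bool.Properties using (T-∧)
open import Data.Fin using (Fin; zero; suc; _≟_)
open import Data.Fin.Permutation.Components using (transpose; transpose-inverse)
open import Data.Fin.Properties using (any?)
open import Data.Fin.Subset
  using (Subset; inside; outside; ⁅_⁆; _∈_; _∉_; _⊆_; _⊂_; _∪_; _-_; ∣_∣)
  renaming (⊥ to ∅)
open import Data.Fin.Subset.Properties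
open import Data.List using (List; []; _∷_; _++_; map; filter; length; foldr; allFin)
import Data.List.Membership.Propositional as List
open import Data.List.Membership.Propositional.Properties
  using (∈-allFin; ∈-map⁺; ∈-map⁻; ∈-++⁺ˡ; ∈-++⁺ʳ; ∈-++⁻; ∈-∃++; ∈-filter⁺; ∈-filter⁻)
open import Data.List.Properties using (length-++; length-map; filter-idem; filter-notAll)
open import Data.List.Relation.Binary.Sublist.Propositional.Properties
  using (length-mono-≤; filter⁺)
open import Data.List.Relation.Binary.Sublist.Propositional using () renaming (⊆-refl to sublist-refl)
open import Data.List.Relation.Unary.All using (All; []; _∷_; lookup)
import Data.List.Relation.Unary.All as All
open import Data.List.Relation.Unary.AllPairs using ([]; _∷_)
open import Data.List.Relation.Unary.Any using (here; there)
import Data.List.Relation.Unary.Any as Any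
open import Data.List.Relation.Unary.Unique.Propositional using (Unique)
import Data.List.Relation.Unary.Unique.Propositional.Properties as Unique
open import Data.Nat using (ℕ; zero; suc; _+_; _⊔_; _≤_; _<_; _≥_; _≤?_; z≤n; s≤s; s≤s⁻¹)
import Data.Nat as ℕ
open import Data.Nat.Properties
  using (≤-refl; ≤-trans; ≤-reflexive; <⇒≱; ≰⇒>; ≤-antisym; ≮⇒≥; 1+n≰n; n≮0;
         m≤m+n; +-suc; ⊔-sel; m≤m⊔n; m≤n⊔m; module ≤-Reasoning)
open import Data.Product using (∃-syntax; _×_; _,_; proj₂)
open import Data.Sum using (_⊎_; inj₁; inj₂; [_,_])
import Data.Sum as Sum
open import Data.Vec using ([]; _∷_; tabulate; here; there)
import Data.Vec as Vec
open import Data.Vec.Properties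
  using (∷-injectiveʳ; lookup∘tabulate; tabulate∘lookup; tabulate-cong; []=⇒lookup; lookup⇒[]=)
open import Function using (id; _∘_; _⇔_; mk⇔; Equivalence)
open import Function.Definitions using (Injective)
open import Level using (0ℓ)
open import Relation.Nullary using (¬_; yes; no; contradiction; ¬?; _×-dec_)
open import Relation.Nullary.Decidable using (⌊_⌋; T?; toWitness; fromWitness; decidable-stable)
open import Relation.Unary using (Pred; Decidable)
open import Relation.Binary.PropositionalEquality
  using (_≡_; _≢_; refl; sym; trans; cong; subst; module ≡-Reasoning)
open import Defs

private variable
  n : ℕ
  p q : Subset n
  x y : Fin n

-- Counting filtered lists

module _ {A : Set} where

  Unique∧⊆⇒length≤ : {xs ys : List A} → Unique xs → (∀ {a} → a List.∈ xs → a List.∈ ys) →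
                     length xs ≤ length ys
  Unique∧⊆⇒length≤ [] _ = z≤n
  Unique∧⊆⇒length≤ {x ∷ xs} {ys} (x∉xs ∷ unique) xs⊆ys with ∈-∃++ (xs⊆ys (here refl))
  ... | us , vs , refl = begin
    suc (length xs)           ≤⟨ s≤s (Unique∧⊆⇒length≤ unique xs⊆us++vs) ⟩
    suc (length (us ++ vs))   ≡⟨ cong suc (length-++ us) ⟩
    suc (length us + length vs) ≡⟨ +-suc (length us) (length vs) ⟨
    length us + length (x ∷ vs) ≡⟨ length-++ us ⟨
    length (us ++ x ∷ vs)     ∎
    where
    open ≤-Reasoning
    xs⊆us++vs : ∀ {a} → a List.∈ xs → a List.∈ us ++ vs
    xs⊆us++vs a∈xs with ∈-++⁻ us (xs⊆ys (there a∈xs))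
    ... | inj₁ a∈us         = ∈-++⁺ˡ a∈us
    ... | inj₂ (here refl)  = contradiction refl (lookup x∉xs a∈xs)
    ... | inj₂ (there a∈vs) = ∈-++⁺ʳ us a∈vs

  module _ {P Q : Pred A 0ℓ} (P? : Decidable P) (Q? : Decidable Q) where

    filter-injective-length≤ : (h : A → A) → Injective _≡_ _≡_ h → (∀ {a} → P a → Q (h a)) →
                               {xs ys : List A} → Unique xs → (∀ a → a List.∈ ys) →
                               length (filter P? xs) ≤ length (filter Q? ys)
    filter-injective-length≤ h h-injective P⇒Qh {xs} {ys} unique complete = begin
      length (filter P? xs)         ≡⟨ length-map h (filter P? xs) ⟨
      length (map h (filter P? xs)) ≤⟨ Unique∧⊆⇒length≤ (Unique.map⁺ h-injective (Unique.filter⁺ P? unique)) image⊆ ⟩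
      length (filter Q? ys)         ∎
      where
      open ≤-Reasoning
      image⊆ : ∀ {b} → b List.∈ map h (filter P? xs) → b List.∈ filter Q? ys
      image⊆ b∈ with ∈-map⁻ h b∈
      ... | a , a∈ , refl = ∈-filter⁺ Q? (complete (h a)) (P⇒Qh (proj₂ (∈-filter⁻ P? {xs = xs} a∈)))

    filter-mono-length< : (∀ {a} → P a → Q a) → ∀ {a xs} → a List.∈ xs → Q a → ¬ P a →
                          length (filter P? xs) < length (filter Q? xs)
    filter-mono-length< P⇒Q {a} {xs} a∈xs Qa ¬Pa = begin-strict
      length (filter P? xs)                ≡⟨ cong length (filter-idem P? xs) ⟨
      length (filter P? (filter P? xs))    ≤⟨ length-mono-≤ (filter⁺ P? P? (λ { refl → id })
                                                                (filter⁺ P? Q? (λ { refl → P⇒Q }) (sublist-refl {x = xs}))) ⟩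
      length (filter P? (filter Q? xs))    <⟨ filter-notAll P? (filter Q? xs)
                                                (Any.map (λ { refl → ¬Pa }) (∈-filter⁺ Q? a∈xs Qa)) ⟩
      length (filter Q? xs)                ∎
      where open ≤-Reasoning

-- Finite subsets

x∈p∪⁅y⁆⁻ : x ∈ p ∪ ⁅ y ⁆ → x ∈ p ⊎ x ≡ y
x∈p∪⁅y⁆⁻ {p = p} {y = y} x∈ = Sum.map₂ (x∈⁅y⁆⇒x≡y y) (x∈p∪q⁻ p ⁅ y ⁆ x∈)

y∈p∪⁅y⁆ : y ∈ p ∪ ⁅ y ⁆
y∈p∪⁅y⁆ {y = y} {p = p} = q⊆p∪q p ⁅ y ⁆ (x∈⁅x⁆ y)

x∉p-x : x ∉ p - x
x∉p-x {x = zero}  {p = s ∷ p} ()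
x∉p-x {x = suc x} {p = s ∷ p} (there x∈) = x∉p-x {p = p} x∈

x∈p-y⇒x≢y : x ∈ p - y → x ≢ y
x∈p-y⇒x≢y {p = p} x∈ refl = x∉p-x {p = p} x∈

x∈p-y⇒x∈p : x ∈ p - y → x ∈ p
x∈p-y⇒x∈p {p = p} {y = y} = p─q⊆p p ⁅ y ⁆

x∈p⇒p∪⁅x⁆≡p : x ∈ p → p ∪ ⁅ x ⁆ ≡ p
x∈p⇒p∪⁅x⁆≡p x∈p = ⊆-antisym (λ y∈ → [ id , (λ { refl → x∈p }) ] (x∈p∪⁅y⁆⁻ y∈)) (p⊆p∪q _)

∣p∣≡1+∣p-x∣ : x ∈ p → ∣ p ∣ ≡ suc ∣ p - x ∣
∣p∣≡1+∣p-x∣ {p = inside  ∷ p} here       = cong (suc ∘ ∣_∣) (sym (p─⊥≡p p))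
∣p∣≡1+∣p-x∣ {p = inside  ∷ p} (there x∈) = cong suc (∣p∣≡1+∣p-x∣ x∈)
∣p∣≡1+∣p-x∣ {p = outside ∷ p} (there x∈) = ∣p∣≡1+∣p-x∣ x∈

∣p∪⁅x⁆∣≡1+∣p∣ : x ∉ p → ∣ p ∪ ⁅ x ⁆ ∣ ≡ suc ∣ p ∣
∣p∪⁅x⁆∣≡1+∣p∣ {x = zero}  {p = inside  ∷ p} x∉ = contradiction here x∉
∣p∪⁅x⁆∣≡1+∣p∣ {x = zero}  {p = outside ∷ p} x∉ = cong (suc ∘ ∣_∣) (∪-identityʳ p)
∣p∪⁅x⁆∣≡1+∣p∣ {x = suc x} {p = inside  ∷ p} x∉ = cong suc (∣p∪⁅x⁆∣≡1+∣p∣ (x∉ ∘ there))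
∣p∪⁅x⁆∣≡1+∣p∣ {x = suc x} {p = outside ∷ p} x∉ = ∣p∪⁅x⁆∣≡1+∣p∣ (x∉ ∘ there)

∣p-y∪⁅x⁆∣≡∣p∣ : y ∈ p → x ∉ p → ∣ (p - y) ∪ ⁅ x ⁆ ∣ ≡ ∣ p ∣
∣p-y∪⁅x⁆∣≡∣p∣ {p = p} y∈p x∉p =
  trans (∣p∪⁅x⁆∣≡1+∣p∣ (x∉p ∘ x∈p-y⇒x∈p {p = p})) (sym (∣p∣≡1+∣p-x∣ y∈p))

∪-least : ∀ {r : Subset n} → p ⊆ r → q ⊆ r → p ∪ q ⊆ r
∪-least {p = p} {q = q} p⊆r q⊆r x∈ = [ p⊆r , q⊆r ] (x∈p∪q⁻ p q x∈)

p⊆q∧x∈q⇒p∪⁅x⁆⊆q : p ⊆ q → x ∈ q → p ∪ ⁅ x ⁆ ⊆ q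
p⊆q∧x∈q⇒p∪⁅x⁆⊆q p⊆q x∈q y∈ = [ p⊆q , (λ { refl → x∈q }) ] (x∈p∪⁅y⁆⁻ y∈)

p-x⊆q∧x∈q⇒p⊆q : p - x ⊆ q → x ∈ q → p ⊆ q
p-x⊆q∧x∈q⇒p⊆q {x = x} p-x⊆q x∈q {y} y∈p with y ≟ x
... | yes refl = x∈q
... | no  y≢x  = p-x⊆q (x∈p∧x≢y⇒x∈p-y y∈p y≢x)

p⊆q∧∣q∣≤∣p∣⇒p≡q : p ⊆ q → ∣ q ∣ ≤ ∣ p ∣ → p ≡ q
p⊆q∧∣q∣≤∣p∣⇒p≡q {p = p} p⊆q ∣q∣≤∣p∣ = ⊆-antisym p⊆q q⊆p
  where
  q⊆p : _ ⊆ p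
  q⊆p {x} x∈q with x ∈? p
  ... | yes x∈p = x∈p
  ... | no  x∉p = contradiction ∣q∣≤∣p∣ (<⇒≱ (p⊂q⇒∣p∣<∣q∣ (p⊆q , x , x∈q , x∉p)))

-- Transposing two points of a subset

module _ (f g : Fin n) where

  transpose-matchˡ : transpose f g f ≡ g
  transpose-matchˡ with f ≟ f
  ... | yes _   = refl
  ... | no  f≢f = contradiction refl f≢f

  transpose-matchʳ : transpose f g g ≡ f
  transpose-matchʳ with g ≟ f
  ... | yes g≡f = g≡f
  ... | no  _ with g ≟ g
  ...   | yes _   = refl
  ...   | no  g≢g = contradiction refl g≢g

  transpose-nomatch : x ≢ f → x ≢ g → transpose f g x ≡ x
  transpose-nomatch {x = x} x≢f x≢g with x ≟ f
  ... | yes x≡f = contradiction x≡f x≢f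
  ... | no  _ with x ≟ g
  ...   | yes x≡g = contradiction x≡g x≢g
  ...   | no  _   = refl

swap : Fin n → Fin n → Subset n → Subset n
swap f g p = tabulate (Vec.lookup p ∘ transpose f g)

module _ {f g : Fin n} where

  lookup-swap : ∀ p x → Vec.lookup (swap f g p) x ≡ Vec.lookup p (transpose f g x)
  lookup-swap p = lookup∘tabulate (Vec.lookup p ∘ transpose f g)

  x∈swap⁻ : x ∈ swap f g p → transpose f g x ∈ p
  x∈swap⁻ {x = x} {p = p} x∈ = lookup⇒[]= _ p (trans (sym (lookup-swap p x)) ([]=⇒lookup x∈))

  x∈swap⁺ : transpose f g x ∈ p → x ∈ swap f g p
  x∈swap⁺ {x = x} {p = p} x∈ = lookup⇒[]= x _ (trans (lookup-swap p x) ([]=⇒lookup x∈))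

  swap-injective : Injective _≡_ _≡_ (swap f g)
  swap-injective {p} {q} eq = trans (sym (swap-inverse p)) (trans (cong (swap g f) eq) (swap-inverse q))
    where
    swap-inverse : ∀ p → swap g f (swap f g p) ≡ p
    swap-inverse p = begin
      tabulate (Vec.lookup (swap f g p) ∘ transpose g f)        ≡⟨ tabulate-cong (lookup-swap p ∘ transpose g f) ⟩
      tabulate (Vec.lookup p ∘ transpose f g ∘ transpose g f)   ≡⟨ tabulate-cong (cong (Vec.lookup p) ∘ λ x → transpose-inverse f g) ⟩
      tabulate (Vec.lookup p)                                   ≡⟨ tabulate∘lookup p ⟩
      p                                                         ∎
      where open ≡-Reasoning

  f∈swap : g ∈ p → f ∈ swap f g p
  f∈swap g∈p = x∈swap⁺ (subst (_∈ _) (sym (transpose-matchˡ f g)) g∈p)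

  swap-fixes : f ∈ p → g ∈ p → swap f g p ≡ p
  swap-fixes {p = p} f∈p g∈p = ⊆-antisym to from
    where
    to : swap f g p ⊆ p
    to {x} x∈ with x ≟ f | x ≟ g
    ... | yes refl | _        = f∈p
    ... | no  _    | yes refl = g∈p
    ... | no  x≢f  | no  x≢g  = subst (_∈ p) (transpose-nomatch f g x≢f x≢g) (x∈swap⁻ x∈)
    from : p ⊆ swap f g p
    from {x} x∈ with x ≟ f | x ≟ g
    ... | yes refl | _        = f∈swap g∈p
    ... | no  _    | yes refl = x∈swap⁺ (subst (_∈ p) (sym (transpose-matchʳ f g)) f∈p)
    ... | no  x≢f  | no  x≢g  = x∈swap⁺ (subst (_∈ p) (sym (transpose-nomatch f g x≢f x≢g)) x∈)

  swap-moves : g ∈ p → f ∉ p → swap f g p ≡ (p - g) ∪ ⁅ f ⁆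
  swap-moves {p = p} g∈p f∉p = ⊆-antisym to from
    where
    to : swap f g p ⊆ (p - g) ∪ ⁅ f ⁆
    to {x} x∈ with x ≟ f | x ≟ g
    ... | yes refl | _        = y∈p∪⁅y⁆
    ... | no  _    | yes refl = contradiction (subst (_∈ p) (transpose-matchʳ f g) (x∈swap⁻ x∈)) f∉p
    ... | no  x≢f  | no  x≢g  =
      p⊆p∪q _ (x∈p∧x≢y⇒x∈p-y (subst (_∈ p) (transpose-nomatch f g x≢f x≢g) (x∈swap⁻ x∈)) x≢g)
    from : (p - g) ∪ ⁅ f ⁆ ⊆ swap f g p
    from {x} x∈ with x∈p∪⁅y⁆⁻ x∈
    ... | inj₂ refl = f∈swap g∈p
    ... | inj₁ x∈p-g with x ≟ f
    ...   | yes refl = contradiction (x∈p-y⇒x∈p {p = p} x∈p-g) f∉p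
    ...   | no  x≢f  = x∈swap⁺ (subst (_∈ p) (sym (transpose-nomatch f g x≢f (x∈p-y⇒x≢y {p = p} x∈p-g)))
                                            (x∈p-y⇒x∈p {p = p} x∈p-g))

T-allL⇔All : ∀ {A : Set} {P : A → Bool} {xs : List A} → T (allL P xs) ⇔ All (T ∘ P) xs
T-allL⇔All {xs = []}     = mk⇔ (λ _ → []) _
T-allL⇔All {P = P} {xs = a ∷ xs} = mk⇔
  (λ T∧ → let (Ta , Tall) = Equivalence.to (T-∧ {P a}) T∧ in Ta ∷ Equivalence.to T-allL⇔All Tall)
  (λ { (Ta ∷ all) → Equivalence.from (T-∧ {P a}) (Ta , Equivalence.from T-allL⇔All all) })

allSubsets-complete : ∀ (p : Subset n) → p List.∈ allSubsets n
allSubsets-complete [] = here refl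
allSubsets-complete {suc n} (inside ∷ p) = ∈-++⁺ˡ (∈-map⁺ (inside ∷_) (allSubsets-complete p))
allSubsets-complete {suc n} (outside ∷ p) =
  ∈-++⁺ʳ (map (inside ∷_) (allSubsets n)) (∈-map⁺ (outside ∷_) (allSubsets-complete p))

allSubsets-unique : ∀ n → Unique (allSubsets n)
allSubsets-unique zero    = [] ∷ []
allSubsets-unique (suc n) =
  Unique.++⁺ (Unique.map⁺ ∷-injectiveʳ (allSubsets-unique n)) (Unique.map⁺ ∷-injectiveʳ (allSubsets-unique n)) disjoint
  where
  disjoint : ∀ {p} → ¬ (p List.∈ map (inside ∷_) (allSubsets n) × p List.∈ map (outside ∷_) (allSubsets n))
  disjoint (p∈ , p∈′) with ∈-map⁻ (inside ∷_) p∈ | ∈-map⁻ (outside ∷_) p∈′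
  ... | _ , _ , refl | _ , _ , ()

-- Bases, rank and circuits

module _ {n : ℕ} (M : Matroid n) where

  private variable
    B C D I K X : Subset n
    e f g : Fin n

  record IsBasis (X B : Subset n) : Set where
    field
      independent : Independent M B
      B⊆X         : B ⊆ X
      maximal     : ∀ {x} → x ∈ X → x ∉ B → ¬ Independent M (B ∪ ⁅ x ⁆)

  open IsBasis

  private
    extendable : Subset n → Subset n → Fin n → Bool
    extendable X B x = ⌊ x ∈? X ⌋ ∧ not ⌊ x ∈? B ⌋ ∧ indep M (B ∪ ⁅ x ⁆)

    T-not-extendable⇔ : T (not (extendable X B x)) ⇔ (x ∈ X → x ∉ B → ¬ Independent M (B ∪ ⁅ x ⁆))
    T-not-extendable⇔ {X} {B} {x} with x ∈? X | x ∈? B | indep M (B ∪ ⁅ x ⁆)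
    ... | no x∉X | _      | _     = mk⇔ (λ _ x∈X → contradiction x∈X x∉X) _
    ... | yes _  | yes x∈B | _     = mk⇔ (λ _ _ x∉B → contradiction x∈B x∉B) _
    ... | yes _  | no _   | false = mk⇔ (λ _ _ _ ()) _
    ... | yes x∈X | no x∉B | true = mk⇔ (λ ()) (λ max → max x∈X x∉B _)

  T-isBasisOfRestriction⇔ : T (isBasisOfRestriction M X B) ⇔ IsBasis X B
  T-isBasisOfRestriction⇔ {X} {B} = mk⇔ to from
    where
    to : T (isBasisOfRestriction M X B) → IsBasis X B
    to T-basis with Equivalence.to (T-∧ {indep M B}) T-basis
    ... | indB , T-rest with Equivalence.to (T-∧ {⌊ B ⊆? X ⌋}) T-rest
    ... | T-B⊆X , T-max = record
      { independent = indB
      ; B⊆X         = toWitness T-B⊆X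
      ; maximal     = λ {x} → Equivalence.to T-not-extendable⇔
                        (lookup (Equivalence.to T-allL⇔All T-max) (∈-allFin x))
      }
    from : IsBasis X B → T (isBasisOfRestriction M X B)
    from basis = Equivalence.from (T-∧ {indep M B}) (independent basis , Equivalence.from (T-∧ {⌊ B ⊆? X ⌋})
      ( fromWitness (λ {x} → B⊆X basis {x})
      , Equivalence.from (T-allL⇔All {P = not ∘ extendable X B} {xs = allFin n})
          (All.tabulate λ {x} _ → Equivalence.from (T-not-extendable⇔ {x = x}) (maximal basis))))

  IsBasisContaining : Subset n → Fin n → Subset n → Set
  IsBasisContaining X e B = T (isBasisOfRestriction M X B ∧ ⌊ e ∈? B ⌋)

  isBasisContaining? : ∀ X e → Decidable (IsBasisContaining X e)
  isBasisContaining? X e B = T? (isBasisOfRestriction M X B ∧ ⌊ e ∈? B ⌋)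

  IsBasisContaining⇔ : IsBasisContaining X e B ⇔ (IsBasis X B × e ∈ B)
  IsBasisContaining⇔ {X} {e} {B} = mk⇔
    (λ T∧ → let (T-basis , T-e∈B) = Equivalence.to (T-∧ {isBasisOfRestriction M X B}) T∧
            in Equivalence.to T-isBasisOfRestriction⇔ T-basis , toWitness T-e∈B)
    (λ (basis , e∈B) → Equivalence.from (T-∧ {isBasisOfRestriction M X B})
            (Equivalence.from T-isBasisOfRestriction⇔ basis , fromWitness e∈B))

  RankWitness : Subset n → ℕ → Set
  RankWitness X r = ∃[ K ] Independent M K × K ⊆ X × ∣ K ∣ ≡ r

  private
    sizeIfIndependentIn : Subset n → Subset n → ℕ
    sizeIfIndependentIn X I = if indep M I ∧ ⌊ I ⊆? X ⌋ then ∣ I ∣ else 0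

    rankOver : Subset n → List (Subset n) → ℕ
    rankOver X = foldr (λ I r → sizeIfIndependentIn X I ⊔ r) 0

    rankWitness-0 : RankWitness X 0
    rankWitness-0 = ∅ , indep-⊥ M , (λ {x} → ⊆-min _ {x}) , ∣⊥∣≡0 n

    rankWitness-⊔ : ∀ {a b} → RankWitness X a → RankWitness X b → RankWitness X (a ⊔ b)
    rankWitness-⊔ {X} {a} {b} wa wb with ⊔-sel a b
    ... | inj₁ a⊔b≡a = subst (RankWitness X) (sym a⊔b≡a) wa
    ... | inj₂ a⊔b≡b = subst (RankWitness X) (sym a⊔b≡b) wb

    rankWitness-size : ∀ I → RankWitness X (sizeIfIndependentIn X I)
    rankWitness-size {X} I with indep M I in indI | I ⊆? X
    ... | true  | yes I⊆X = I , subst T (sym indI) _ , I⊆X , refl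
    ... | true  | no _    = rankWitness-0
    ... | false | _       = rankWitness-0

    rankWitness-over : ∀ L → RankWitness X (rankOver X L)
    rankWitness-over []      = rankWitness-0
    rankWitness-over (I ∷ L) = rankWitness-⊔ (rankWitness-size I) (rankWitness-over L)

    sizeIfIndependentIn≡ : Independent M I → I ⊆ X → sizeIfIndependentIn X I ≡ ∣ I ∣
    sizeIfIndependentIn≡ {I} {X} indI I⊆X with indep M I | indI | I ⊆? X
    ... | true | _ | yes _    = refl
    ... | true | _ | no ¬I⊆X = contradiction (λ {x} → I⊆X {x}) ¬I⊆X

    size≤rankOver : Independent M I → I ⊆ X → ∀ {L} → I List.∈ L → ∣ I ∣ ≤ rankOver X L
    size≤rankOver indI I⊆X {J ∷ L} (here refl) =
      ≤-trans (≤-reflexive (sym (sizeIfIndependentIn≡ indI I⊆X))) (m≤m⊔n _ _)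
    size≤rankOver indI I⊆X {J ∷ L} (there I∈L) = ≤-trans (size≤rankOver indI I⊆X I∈L) (m≤n⊔m _ _)

  rank-witness : ∀ X → RankWitness X (rank M X)
  rank-witness X = rankWitness-over (allSubsets n)

  ∣I∣≤rank : Independent M I → I ⊆ X → ∣ I ∣ ≤ rank M X
  ∣I∣≤rank {I} indI I⊆X = size≤rankOver indI I⊆X (allSubsets-complete I)

  Augmentation : Subset n → Subset n → Set
  Augmentation I K = ∃[ J ] Independent M J × I ⊆ J × J ⊆ I ∪ K × ∣ K ∣ ≤ ∣ J ∣

  private
    augment-within : ∀ k → Independent M I → Independent M K → ∣ K ∣ ≤ k + ∣ I ∣ → Augmentation I K
    augment-within {I} {K} zero indI indK bound = I , indI , id , p⊆p∪q K , bound
    augment-within {I} {K} (suc k) indI indK bound with ∣ K ∣ ≤? ∣ I ∣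
    ... | yes ∣K∣≤∣I∣ = I , indI , id , p⊆p∪q K , ∣K∣≤∣I∣
    ... | no  ∣K∣≰∣I∣ with indep-aug M indI indK (≰⇒> ∣K∣≰∣I∣)
    ...   | e , e∈K , e∉I , indIe with augment-within k indIe indK bound′
      where
      bound′ : ∣ K ∣ ≤ k + ∣ I ∪ ⁅ e ⁆ ∣
      bound′ = subst (∣ K ∣ ≤_) (sym (trans (cong (k +_) (∣p∪⁅x⁆∣≡1+∣p∣ e∉I)) (+-suc k ∣ I ∣))) bound
    ...     | J , indJ , Ie⊆J , J⊆IeK , ∣K∣≤∣J∣ = J , indJ , Ie⊆J ∘ p⊆p∪q _ , J⊆I∪K , ∣K∣≤∣J∣
      where
      J⊆I∪K : J ⊆ I ∪ K
      J⊆I∪K = subst (J ⊆_) (trans (∪-assoc I ⁅ e ⁆ K) (cong (I ∪_) (trans (∪-comm ⁅ e ⁆ K) (x∈p⇒p∪⁅x⁆≡p e∈K)))) J⊆IeK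

  augment : Independent M I → Independent M K → Augmentation I K
  augment {I} {K} indI indK = augment-within ∣ K ∣ indI indK (m≤m+n ∣ K ∣ ∣ I ∣)

  rank≤∣B∣⇒IsBasis : Independent M B → B ⊆ X → rank M X ≤ ∣ B ∣ → IsBasis X B
  rank≤∣B∣⇒IsBasis {B} {X} indB B⊆X rank≤∣B∣ = record { independent = indB ; B⊆X = B⊆X ; maximal = maximal′ }
    where
    maximal′ : ∀ {x} → x ∈ X → x ∉ B → ¬ Independent M (B ∪ ⁅ x ⁆)
    maximal′ {x} x∈X x∉B indBx = 1+n≰n (begin
      suc ∣ B ∣      ≡⟨ ∣p∪⁅x⁆∣≡1+∣p∣ x∉B ⟨
      ∣ B ∪ ⁅ x ⁆ ∣  ≤⟨ ∣I∣≤rank indBx (p⊆q∧x∈q⇒p∪⁅x⁆⊆q B⊆X x∈X) ⟩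
      rank M X       ≤⟨ rank≤∣B∣ ⟩
      ∣ B ∣          ∎)
      where open ≤-Reasoning

  IsBasis⇒∣B∣≡rank : IsBasis X B → ∣ B ∣ ≡ rank M X
  IsBasis⇒∣B∣≡rank {X} {B} basis with rank-witness X
  ... | K , indK , K⊆X , ∣K∣≡rank = ≤-antisym (∣I∣≤rank (independent basis) (B⊆X basis)) (≮⇒≥ ∣B∣≮rank)
    where
    ∣B∣≮rank : ¬ ∣ B ∣ < rank M X
    ∣B∣≮rank ∣B∣<rank with indep-aug M (independent basis) indK (subst (∣ B ∣ <_) (sym ∣K∣≡rank) ∣B∣<rank)
    ... | e , e∈K , e∉B , indBe = maximal basis (K⊆X e∈K) e∉B indBe

  extend-to-basis : Independent M I → I ⊆ X → ∃[ B ] IsBasis X B × I ⊆ B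
  extend-to-basis {I} {X} indI I⊆X with rank-witness X
  ... | K , indK , K⊆X , ∣K∣≡rank with augment indI indK
  ...   | J , indJ , I⊆J , J⊆I∪K , ∣K∣≤∣J∣ =
    J , rank≤∣B∣⇒IsBasis indJ (∪-least I⊆X K⊆X ∘ J⊆I∪K) (subst (_≤ ∣ J ∣) ∣K∣≡rank ∣K∣≤∣J∣) , I⊆J

  dependent⇒rank<∣X∣ : ¬ Independent M X → rank M X < ∣ X ∣
  dependent⇒rank<∣X∣ {X} depX with rank-witness X
  ... | K , indK , K⊆X , ∣K∣≡rank =
    ≰⇒> λ ∣X∣≤rank → depX (subst (Independent M) (p⊆q∧∣q∣≤∣p∣⇒p≡q K⊆X (subst (∣ X ∣ ≤_) (sym ∣K∣≡rank) ∣X∣≤rank)) indK)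

  private
    circuit-within : ∀ k → ∣ D ∣ ≤ k → ¬ Independent M D → ∃[ C ] C ⊆ D × IsCircuit M C
    circuit-within {D} k ∣D∣≤k depD with any? (λ x → x ∈? D ×-dec ¬? (T? (indep M (D - x))))
    circuit-within {D} k ∣D∣≤k depD | no noDependentDeletion = D , id , depD , minimal
      where
      minimal : ∀ D′ → D′ ⊂ D → Independent M D′
      minimal D′ (D′⊆D , x , x∈D , x∉D′) with T? (indep M (D - x))
      ... | yes indD-x = indep-⊆ M (λ y∈D′ → x∈p∧x≢y⇒x∈p-y (D′⊆D y∈D′) λ { refl → x∉D′ y∈D′ }) indD-x
      ... | no  depD-x = contradiction (x , x∈D , depD-x) noDependentDeletion
    circuit-within {D} zero ∣D∣≤k depD | yes (x , x∈D , _) =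
      contradiction (subst (_≤ 0) (∣p∣≡1+∣p-x∣ x∈D) ∣D∣≤k) n≮0
    circuit-within {D} (suc k) ∣D∣≤k depD | yes (x , x∈D , depD-x)
      with circuit-within k (s≤s⁻¹ (subst (_≤ suc k) (∣p∣≡1+∣p-x∣ x∈D) ∣D∣≤k)) depD-x
    ... | C , C⊆D-x , circuit = C , x∈p-y⇒x∈p {p = D} ∘ C⊆D-x , circuit

  dependent⇒∃circuit⊆ : ¬ Independent M D → ∃[ C ] C ⊆ D × IsCircuit M C
  dependent⇒∃circuit⊆ = circuit-within _ ≤-refl

  circuit∧C-e⊆I⇒e∉I : IsCircuit M C → Independent M I → C - e ⊆ I → e ∉ I
  circuit∧C-e⊆I⇒e∉I (depC , _) indI C-e⊆I e∈I = depC (indep-⊆ M (p-x⊆q∧x∈q⇒p⊆q C-e⊆I e∈I) indI)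

  fundamental-circuit : Independent M B → ¬ Independent M (B ∪ ⁅ f ⁆) →
                        ∃[ C ] IsCircuit M C × C ⊆ B ∪ ⁅ f ⁆ × f ∈ C
  fundamental-circuit {B} {f} indB depBf with dependent⇒∃circuit⊆ depBf
  ... | C , C⊆Bf , circuit@(depC , _) with f ∈? C
  ...   | yes f∈C = C , circuit , C⊆Bf , f∈C
  ...   | no  f∉C = contradiction (indep-⊆ M C⊆B indB) depC
    where
    C⊆B : C ⊆ B
    C⊆B x∈C = [ id , (λ { refl → contradiction x∈C f∉C }) ] (x∈p∪⁅y⁆⁻ (C⊆Bf x∈C))

  circuit-delete-independent : IsCircuit M C → e ∈ C → Independent M (C - e)
  circuit-delete-independent (_ , minimal) e∈C = minimal _ (x∈p⇒p-x⊂p e∈C)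

  circuit-exchange : Independent M B → g ∈ B → f ∉ B →
                     IsCircuit M C → C ⊆ B ∪ ⁅ f ⁆ → g ∈ C → Independent M ((B - g) ∪ ⁅ f ⁆)
  circuit-exchange {B} {g} {f} {C} indB g∈B f∉B circuit C⊆Bf g∈C
    with augment (circuit-delete-independent circuit g∈C) indB
  ... | J , indJ , C-g⊆J , J⊆C-g∪B , ∣B∣≤∣J∣ = subst (Independent M) J≡B′ indJ
    where
    g∉J : g ∉ J
    g∉J = circuit∧C-e⊆I⇒e∉I circuit indJ C-g⊆J
    J⊆B′ : J ⊆ (B - g) ∪ ⁅ f ⁆
    J⊆B′ {x} x∈J with x∈p∪q⁻ (C - g) B (J⊆C-g∪B x∈J)
    ... | inj₂ x∈B   = p⊆p∪q _ (x∈p∧x≢y⇒x∈p-y x∈B λ { refl → g∉J x∈J })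
    ... | inj₁ x∈C-g with x∈p∪⁅y⁆⁻ (C⊆Bf (x∈p-y⇒x∈p {p = C} x∈C-g))
    ...   | inj₁ x∈B = p⊆p∪q _ (x∈p∧x≢y⇒x∈p-y x∈B (x∈p-y⇒x≢y {p = C} x∈C-g))
    ...   | inj₂ refl = y∈p∪⁅y⁆
    J≡B′ : J ≡ (B - g) ∪ ⁅ f ⁆
    J≡B′ = p⊆q∧∣q∣≤∣p∣⇒p≡q J⊆B′ (subst (_≤ ∣ J ∣) (sym (∣p-y∪⁅x⁆∣≡∣p∣ g∈B f∉B)) ∣B∣≤∣J∣)

  ∈cl-circuit⇒exchange-dependent : IsCircuit M C → f ∈ C → g ∉ C → _∈cl_ M g C →
                                   ¬ Independent M ((C - f) ∪ ⁅ g ⁆)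
  ∈cl-circuit⇒exchange-dependent {C} {f} {g} (depC , _) f∈C g∉C g∈clC indD =
    <⇒≱ (dependent⇒rank<∣X∣ depC) (begin
      ∣ C ∣                   ≡⟨ ∣p-y∪⁅x⁆∣≡∣p∣ f∈C g∉C ⟨
      ∣ (C - f) ∪ ⁅ g ⁆ ∣     ≤⟨ ∣I∣≤rank indD (p⊆q∧x∈q⇒p∪⁅x⁆⊆q (p⊆p∪q _ ∘ x∈p-y⇒x∈p {p = C}) y∈p∪⁅y⁆) ⟩
      rank M (C ∪ ⁅ g ⁆)      ≡⟨ g∈clC ⟩
      rank M C                ∎)
    where open ≤-Reasoning

  freer-exchange : Freer M f g → f ∈ X → IsBasis X B → g ∈ B → f ∉ B → IsBasis X ((B - g) ∪ ⁅ f ⁆)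
  freer-exchange {f} {g} {X} {B} freer f∈X basis g∈B f∉B
    with fundamental-circuit (independent basis) (maximal basis f∈X f∉B)
  ... | C , circuit , C⊆Bf , f∈C = rank≤∣B∣⇒IsBasis indB′ B′⊆X (≤-reflexive rank≡∣B′∣)
    where
    C-f⊆B : C - f ⊆ B
    C-f⊆B x∈C-f = [ id , (λ { refl → contradiction refl (x∈p-y⇒x≢y {p = C} x∈C-f) }) ]
                    (x∈p∪⁅y⁆⁻ (C⊆Bf (x∈p-y⇒x∈p {p = C} x∈C-f)))
    g∈C : g ∈ C
    g∈C with g ∈? C
    ... | yes g∈C = g∈C
    ... | no  g∉C = contradiction (indep-⊆ M (p⊆q∧x∈q⇒p∪⁅x⁆⊆q C-f⊆B g∈B) (independent basis))
                                  (∈cl-circuit⇒exchange-dependent circuit f∈C g∉C (freer C circuit f∈C))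
    indB′ : Independent M ((B - g) ∪ ⁅ f ⁆)
    indB′ = circuit-exchange (independent basis) g∈B f∉B circuit C⊆Bf g∈C
    B′⊆X : (B - g) ∪ ⁅ f ⁆ ⊆ X
    B′⊆X = p⊆q∧x∈q⇒p∪⁅x⁆⊆q (B⊆X basis ∘ x∈p-y⇒x∈p {p = B}) f∈X
    rank≡∣B′∣ : rank M X ≡ ∣ (B - g) ∪ ⁅ f ⁆ ∣
    rank≡∣B′∣ = trans (sym (IsBasis⇒∣B∣≡rank basis)) (sym (∣p-y∪⁅x⁆∣≡∣p∣ g∈B f∉B))

  ∉cl⇒∈basis : ¬ _∈cl_ M g X → IsBasis (X ∪ ⁅ g ⁆) B → g ∈ B
  ∉cl⇒∈basis {g} {X} {B} g∉clX basis with g ∈? B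
  ... | yes g∈B = g∈B
  ... | no  g∉B = contradiction (trans (sym (IsBasis⇒∣B∣≡rank basis)) (IsBasis⇒∣B∣≡rank basisOfX)) g∉clX
    where
    basisOfX : IsBasis X B
    basisOfX = record
      { independent = independent basis
      ; B⊆X         = λ x∈B → [ id , (λ { refl → contradiction x∈B g∉B }) ] (x∈p∪⁅y⁆⁻ (B⊆X basis x∈B))
      ; maximal     = maximal basis ∘ p⊆p∪q _
      }

  freer⇒basesCount≤ : Freer M f g → f ∈ X → basesCount M X g ≤ basesCount M X f
  freer⇒basesCount≤ {f} {g} {X} freer f∈X =
    filter-injective-length≤ (isBasisContaining? X g) (isBasisContaining? X f) (swap f g) swap-injective
      (Equivalence.from IsBasisContaining⇔ ∘ swapped-basis ∘ Equivalence.to IsBasisContaining⇔)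
      (allSubsets-unique n) allSubsets-complete
    where
    swapped-basis : IsBasis X B × g ∈ B → IsBasis X (swap f g B) × f ∈ swap f g B
    swapped-basis {B} (basis , g∈B) with f ∈? B
    ... | yes f∈B = subst (IsBasis X) (sym (swap-fixes f∈B g∈B)) basis , f∈swap g∈B
    ... | no  f∉B = subst (IsBasis X) (sym (swap-moves g∈B f∉B)) (freer-exchange freer f∈X basis g∈B f∉B)
                  , f∈swap g∈B

  ∉cl⇒basesCount< : IsCircuit M C → f ∈ C → ¬ _∈cl_ M g C →
                    basesCount M (C ∪ ⁅ g ⁆) f < basesCount M (C ∪ ⁅ g ⁆) g
  ∉cl⇒basesCount< {C} {f} {g} circuit f∈C g∉clC
    with extend-to-basis (circuit-delete-independent circuit f∈C) (p⊆p∪q _ ∘ x∈p-y⇒x∈p {p = C})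
  ... | B₀ , basis₀ , C-f⊆B₀ =
    filter-mono-length< (isBasisContaining? (C ∪ ⁅ g ⁆) f) (isBasisContaining? (C ∪ ⁅ g ⁆) g)
      (λ Pf → let (basis , _) = Equivalence.to IsBasisContaining⇔ Pf
              in Equivalence.from IsBasisContaining⇔ (basis , ∉cl⇒∈basis g∉clC basis))
      (allSubsets-complete B₀)
      (Equivalence.from IsBasisContaining⇔ (basis₀ , ∉cl⇒∈basis g∉clC basis₀))
      (circuit∧C-e⊆I⇒e∉I circuit (independent basis₀) C-f⊆B₀ ∘ proj₂ ∘ Equivalence.to IsBasisContaining⇔)

lemma10 : ∀ {n} (M : Matroid n) (f g : Fin n) → ¬ (f ≡ g) →
          (Freer M f g → ∀ (X : Subset n) → f ∈ X → g ∈ X → basesCount M X f ≥ basesCount M X g)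
          × ((∀ (X : Subset n) → f ∈ X → g ∈ X → basesCount M X f ≥ basesCount M X g) → Freer M f g)
lemma10 M f g _ = (λ freer X f∈X _ → freer⇒basesCount≤ M freer f∈X) , counts⇒freer
  where
  counts⇒freer : (∀ X → f ∈ X → g ∈ X → basesCount M X f ≥ basesCount M X g) → Freer M f g
  counts⇒freer counts C circuit f∈C = decidable-stable (rank M (C ∪ ⁅ g ⁆) ℕ.≟ rank M C) λ g∉clC →
    <⇒≱ (∉cl⇒basesCount< M circuit f∈C g∉clC) (counts (C ∪ ⁅ g ⁆) (p⊆p∪q _ f∈C) y∈p∪⁅y⁆)
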